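{- Let $r=\frac{1-z^4-z^2-\sqrt{z^8-2z^6-z^4-2z^2+1}}{2z^3}$. The generating function, with respect to size, of all partial zigzag knight's paths (the empty path included) is $$\frac{rz^2+rz+r}{z^3(1-r)}=1+z+2z^2+2z^3+4z^4+5z^5+9z^6+12z^7+21z^8+\cdots,$$ whose coefficient sequence is OEIS A088518.
   Context: Let $N=(1,2)$, $\bar N=(1,-2)$, $E=(2,1)$, $\bar E=(2,-1)$; $N,E$ are up-steps and $\bar N,\bar E$ are down-steps. A knight's path is a lattice path in $\mathbb N^2$ starting at $(0,0)$, ending on the $x$-axis, with steps in $\{N,\bar N,E,\bar E\}$. A zigzag knight's path is a knight's path in which consecutive steps alternate between up-steps and down-steps. A partial zigzag knight's path is a prefix (possibly empty) of a zigzag knight's path. The size of a path is the abscissa of its last point. -}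

module Defs where

open import Data.Nat as ℕ using (ℕ; zero; suc; _∸_)
open import Data.Integer as ℤ using (ℤ; +_; -[1+_]; _+_; _*_; _-_; -_; _≤_)
open import Data.Bool using (Bool; true; false; not)
open import Data.List using (List; []; _∷_; _++_; length)
open import Data.List.Membership.Propositional using (_∈_)
open import Data.List.Relation.Unary.Unique.Propositional using (Unique)
open import Data.Product using (Σ; _×_; ∃)
open import Data.Unit using (⊤)
open import Relation.Nullary using (yes; no)
open import Function.Bundles using (_⇔_)
open import Relation.Binary.PropositionalEquality using (_≡_)

data Step : Set where
  N N̄ E Ē : Step

dx : Step → ℕ
dx N = 1
dx N̄ = 1
dx E = 2
dx Ē = 2

dy : Step → ℤ
dy N = + 2
dy N̄ = - (+ 2)
dy E = + 1
dy Ē = - (+ 1)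

isUp : Step → Bool
isUp N = true
isUp N̄ = false
isUp E = true
isUp Ē = false

Path : Set
Path = List Step

-- size = abscissa of the last point (path starts at (0,0))
size : Path → ℕ
size [] = 0
size (s ∷ p) = dx s ℕ.+ size p

-- all points visited after starting at height h have nonnegative ordinate
-- (abscissae are automatically nonnegative)
StaysAbove : ℤ → Path → Set
StaysAbove h [] = ⊤
StaysAbove h (s ∷ p) = (+ 0 ≤ h + dy s) × StaysAbove (h + dy s) p

endHeight : ℤ → Path → ℤ
endHeight h [] = h
endHeight h (s ∷ p) = endHeight (h + dy s) p

KnightPath : Path → Set
KnightPath p = StaysAbove (+ 0) p × (endHeight (+ 0) p ≡ + 0)

Alternating : Path → Set
Alternating [] = ⊤
Alternating (s ∷ []) = ⊤
Alternating (s ∷ t ∷ p) = (isUp t ≡ not (isUp s)) × Alternating (t ∷ p)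

ZigzagKnightPath : Path → Set
ZigzagKnightPath p = KnightPath p × Alternating p

PartialZigzag : Path → Set
PartialZigzag p = ∃ λ q → ZigzagKnightPath (p ++ q)

IsCount : ℕ → ℕ → Set
IsCount n k = Σ (List Path) λ L →
  Unique L × (∀ p → (p ∈ L) ⇔ (PartialZigzag p × size p ≡ n)) × (length L ≡ k)

PS : Set
PS = ℕ → ℤ

_≋_ : PS → PS → Set
f ≋ g = ∀ n → f n ≡ g n

infixl 6 _⊕_ _⊖_
infixl 7 _⊗_
infix 4 _≋_

_⊕_ : PS → PS → PS
(f ⊕ g) n = f n + g n

_⊖_ : PS → PS → PS
(f ⊖ g) n = f n - g n

convAux : PS → PS → ℕ → ℕ → ℤ
convAux f g n zero = + 0
convAux f g n (suc k) = convAux f g n k + f k * g (n ∸ k)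

_⊗_ : PS → PS → PS
(f ⊗ g) n = convAux f g n (suc n)

mono : ℤ → ℕ → PS
mono c k n with k ℕ.≟ n
... | yes _ = c
... | no _ = + 0

z^ : ℕ → PS
z^ k = mono (+ 1) k

one : PS
one = z^ 0

gf : (ℕ → ℕ) → PS
gf a n = + a n

Disc : PS
Disc = z^ 8 ⊖ mono (+ 2) 6 ⊖ z^ 4 ⊖ mono (+ 2) 2 ⊕ one

Numer : PS
Numer = one ⊖ z^ 4 ⊖ z^ 2

IsSqrtDisc : PS → Set
IsSqrtDisc s = (s 0 ≡ + 1) × (s ⊗ s ≋ Disc)

-- r = (Numer - s) / (2 z^3)
IsR : PS → PS → Set
IsR s r = mono (+ 2) 3 ⊗ r ≋ Numer ⊖ s

module Submission where

-- Let U_h count partial zigzag paths that start at height h and whose first step goes up.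
-- Splitting off the first up-step and the down-step after it gives
--   U_h = 1 + z + z² + (z² + z⁴) U_h + z³ U_{h+1} + z³ U_{h-1}   (last term only for h ≥ 1),
-- which determines the family coefficient by coefficient.  The statement's r is exactly the
-- power-series root of r = z³ + (z² + z⁴) r + z³ r², and U_h = (1 - r^{h+1}) / (1 - z - z²)
-- solves the recurrence: the constant part because 1 - z² - 2z³ - z⁴ = (1 - z - z²)(1 + z + z²),
-- the part r^{h+1} because r is a root, and at h = 0 the missing term is harmless since 1 - r⁰ = 0.
-- Finally z³ (1 - r)² = r (1 + z + z²)(1 - z - z²) turns U_0 into the claimed formula.  Every
-- such identity is a polynomial identity modulo these two relations, checked by the ring solver
-- in the commutative ring of formal power series.

open import Defs
open import Level using (0ℓ)
open import Algebra using (CommutativeRing)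
import Algebra.Construct.Pointwise as Pointwise
import Algebra.Solver.Ring
open import Algebra.Solver.Ring.AlmostCommutativeRing
  using (fromCommutativeRing; _-Raw-AlmostCommutative⟶_; Induced-equivalence)
open import Data.Bool using (Bool; true; false; not)
open import Data.Empty using (⊥; ⊥-elim)
open import Data.Integer as ℤ using (ℤ; +_; _+_; _*_; _-_; -_)
import Data.Integer.Properties as ℤP
open import Data.Integer.Tactic.RingSolver using (solve-∀)
open import Data.List using (List; []; _∷_; _++_; map; length)
open import Data.List.Membership.Propositional using (_∈_)
open import Data.List.Membership.Propositional.Properties using (∈-map⁺; ∈-map⁻; ∈-++⁺ˡ; ∈-++⁺ʳ; ∈-++⁻)
open import Data.List.Membership.Propositional.Properties.WithK using (unique∧set⇒bag)
open import Data.List.Properties using (∷-injectiveˡ; ∷-injectiveʳ; length-++; length-map)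
open import Data.List.Relation.Binary.BagAndSetEquality using (∼bag⇒↭)
open import Data.List.Relation.Binary.Permutation.Propositional.Properties using (↭-length)
open import Data.List.Relation.Unary.All using ([])
open import Data.List.Relation.Unary.AllPairs using ([]; _∷_)
open import Data.List.Relation.Unary.Any using (here)
open import Data.List.Relation.Unary.Unique.Propositional using (Unique)
import Data.List.Relation.Unary.Unique.Propositional.Properties as Unique
open import Data.Maybe using (just; nothing)
open import Data.Nat as ℕ using (ℕ; zero; suc; _∸_; _<_; _≤_; z≤n; s≤s)
open import Data.Nat.Induction using (<-rec)
import Data.Nat.Properties as ℕP
open import Data.Nat.Tactic.RingSolver using () renaming (solve-∀ to ℕ-solve-∀)
open import Data.Product using (Σ; _×_; ∃; _,_)
open import Data.Sum using (inj₁; inj₂)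
open import Data.Unit using (⊤; tt)
open import Function.Bundles using (_⇔_; mk⇔; Equivalence)
open import Relation.Binary.Definitions using (WeaklyDecidable)
open import Relation.Binary.PropositionalEquality
import Relation.Binary.Reasoning.Setoid
open import Relation.Nullary using (yes; no)

tail : PS → PS
tail f n = f (suc n)

0ₛ : PS
0ₛ _ = + 0

scale : ℤ → PS → PS
scale c f n = c * f n

≋-refl : ∀ {f} → f ≋ f
≋-refl _ = refl

convAux-cong : ∀ {f f′ g g′} → f ≋ f′ → g ≋ g′ → ∀ n k → convAux f g n k ≡ convAux f′ g′ n k
convAux-cong f≋ g≋ n zero    = refl
convAux-cong f≋ g≋ n (suc k) = cong₂ _+_ (convAux-cong f≋ g≋ n k) (cong₂ _*_ (f≋ k) (g≋ (n ∸ k)))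

⊗-cong : ∀ {f f′ g g′} → f ≋ f′ → g ≋ g′ → f ⊗ g ≋ f′ ⊗ g′
⊗-cong f≋ g≋ n = convAux-cong f≋ g≋ n (suc n)

convAux-tailˡ : ∀ f g n k → convAux f g (suc n) (suc k) ≡ f 0 * g (suc n) + convAux (tail f) g n k
convAux-tailˡ f g n zero    = trans (ℤP.+-identityˡ (f 0 * g (suc n))) (sym (ℤP.+-identityʳ (f 0 * g (suc n))))
convAux-tailˡ f g n (suc k) = trans (cong (_+ f (suc k) * g (n ∸ k)) (convAux-tailˡ f g n k))
  (ℤP.+-assoc (f 0 * g (suc n)) (convAux (tail f) g n k) (f (suc k) * g (n ∸ k)))

convAux-tailʳ : ∀ f g n k → k ≤ suc n → convAux f g (suc n) k ≡ convAux f (tail g) n k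
convAux-tailʳ f g n zero    _         = refl
convAux-tailʳ f g n (suc k) (s≤s k≤n) = cong₂ _+_ (convAux-tailʳ f g n k (ℕP.m≤n⇒m≤1+n k≤n))
  (cong (λ m → f k * g m) (ℕP.+-∸-assoc 1 k≤n))

⊗-coeff-zero : ∀ f g → (f ⊗ g) 0 ≡ f 0 * g 0
⊗-coeff-zero f g = ℤP.+-identityˡ (f 0 * g 0)

⊗-coeff-sucˡ : ∀ f g n → (f ⊗ g) (suc n) ≡ f 0 * g (suc n) + (tail f ⊗ g) n
⊗-coeff-sucˡ f g n = convAux-tailˡ f g n (suc n)

⊗-coeff-sucʳ : ∀ f g n → (f ⊗ g) (suc n) ≡ (f ⊗ tail g) n + f (suc n) * g 0
⊗-coeff-sucʳ f g n = cong₂ _+_ (convAux-tailʳ f g n (suc n) ℕP.≤-refl)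
  (cong (λ m → f (suc n) * g m) (ℕP.n∸n≡0 n))

⊗-comm : ∀ f g → f ⊗ g ≋ g ⊗ f
⊗-comm f g zero    = trans (⊗-coeff-zero f g) (trans (ℤP.*-comm (f 0) (g 0)) (sym (⊗-coeff-zero g f)))
⊗-comm f g (suc n) = begin
  (f ⊗ g) (suc n)                       ≡⟨ ⊗-coeff-sucˡ f g n ⟩
  f 0 * g (suc n) + (tail f ⊗ g) n     ≡⟨ cong₂ _+_ (ℤP.*-comm (f 0) (g (suc n))) (⊗-comm (tail f) g n) ⟩
  g (suc n) * f 0 + (g ⊗ tail f) n     ≡⟨ ℤP.+-comm (g (suc n) * f 0) ((g ⊗ tail f) n) ⟩
  (g ⊗ tail f) n + g (suc n) * f 0     ≡⟨ ⊗-coeff-sucʳ g f n ⟨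
  (g ⊗ f) (suc n)                       ∎
  where open ≡-Reasoning

convAux-distribˡ : ∀ f g h n k → convAux f (g ⊕ h) n k ≡ convAux f g n k + convAux f h n k
convAux-distribˡ f g h n zero    = refl
convAux-distribˡ f g h n (suc k) =
  trans (cong (_+ f k * (g (n ∸ k) + h (n ∸ k))) (convAux-distribˡ f g h n k))
        (shuffle (convAux f g n k) (convAux f h n k) (f k) (g (n ∸ k)) (h (n ∸ k)))
  where
  shuffle : ∀ a b x y z → (a + b) + x * (y + z) ≡ (a + x * y) + (b + x * z)
  shuffle = solve-∀

⊗-distribˡ-⊕ : ∀ f g h → f ⊗ (g ⊕ h) ≋ f ⊗ g ⊕ f ⊗ h
⊗-distribˡ-⊕ f g h n = convAux-distribˡ f g h n (suc n)

⊗-distribʳ-⊕ : ∀ f g h → (g ⊕ h) ⊗ f ≋ g ⊗ f ⊕ h ⊗ f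
⊗-distribʳ-⊕ f g h n = begin
  ((g ⊕ h) ⊗ f) n           ≡⟨ ⊗-comm (g ⊕ h) f n ⟩
  (f ⊗ (g ⊕ h)) n           ≡⟨ ⊗-distribˡ-⊕ f g h n ⟩
  (f ⊗ g) n + (f ⊗ h) n     ≡⟨ cong₂ _+_ (⊗-comm f g n) (⊗-comm f h n) ⟩
  (g ⊗ f) n + (h ⊗ f) n     ∎
  where open ≡-Reasoning

convAux-scaleˡ : ∀ c f g n k → convAux (scale c f) g n k ≡ c * convAux f g n k
convAux-scaleˡ c f g n zero    = sym (ℤP.*-zeroʳ c)
convAux-scaleˡ c f g n (suc k) =
  trans (cong (_+ c * f k * g (n ∸ k)) (convAux-scaleˡ c f g n k))
        (factor c (convAux f g n k) (f k) (g (n ∸ k)))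
  where
  factor : ∀ c a x y → c * a + c * x * y ≡ c * (a + x * y)
  factor = solve-∀

⊗-scaleˡ : ∀ c f g → scale c f ⊗ g ≋ scale c (f ⊗ g)
⊗-scaleˡ c f g n = convAux-scaleˡ c f g n (suc n)

convAux-zeroˡ : ∀ g n k → convAux 0ₛ g n k ≡ + 0
convAux-zeroˡ g n zero    = refl
convAux-zeroˡ g n (suc k) = cong (_+ + 0) (convAux-zeroˡ g n k)

⊗-zeroˡ : ∀ g → 0ₛ ⊗ g ≋ 0ₛ
⊗-zeroˡ g n = convAux-zeroˡ g n (suc n)

const : ℤ → PS
const c = mono c 0

const-⊗ : ∀ c g → const c ⊗ g ≋ scale c g
const-⊗ c g zero    = ⊗-coeff-zero (const c) g
const-⊗ c g (suc n) = trans (⊗-coeff-sucˡ (const c) g n)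
  (trans (cong (_+_ (c * g (suc n))) (⊗-zeroˡ g n)) (ℤP.+-identityʳ (c * g (suc n))))

⊗-identityˡ : ∀ g → one ⊗ g ≋ g
⊗-identityˡ g n = trans (const-⊗ (+ 1) g n) (ℤP.*-identityˡ (g n))

⊗-identityʳ : ∀ g → g ⊗ one ≋ g
⊗-identityʳ g n = trans (⊗-comm g one n) (⊗-identityˡ g n)

⊗-assoc : ∀ f g h → (f ⊗ g) ⊗ h ≋ f ⊗ (g ⊗ h)
⊗-assoc f g h zero = begin
  ((f ⊗ g) ⊗ h) 0        ≡⟨ ⊗-coeff-zero (f ⊗ g) h ⟩
  (f ⊗ g) 0 * h 0        ≡⟨ cong (_* h 0) (⊗-coeff-zero f g) ⟩
  f 0 * g 0 * h 0        ≡⟨ ℤP.*-assoc (f 0) (g 0) (h 0) ⟩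
  f 0 * (g 0 * h 0)      ≡⟨ cong (f 0 *_) (⊗-coeff-zero g h) ⟨
  f 0 * (g ⊗ h) 0        ≡⟨ ⊗-coeff-zero f (g ⊗ h) ⟨
  (f ⊗ (g ⊗ h)) 0        ∎
  where open ≡-Reasoning
⊗-assoc f g h (suc n) = begin
  ((f ⊗ g) ⊗ h) (suc n)
    ≡⟨ ⊗-coeff-sucˡ (f ⊗ g) h n ⟩
  (f ⊗ g) 0 * h (suc n) + (tail (f ⊗ g) ⊗ h) n
    ≡⟨ cong₂ _+_ (cong (_* h (suc n)) (⊗-coeff-zero f g)) (⊗-cong (⊗-coeff-sucˡ f g) ≋-refl n) ⟩
  f 0 * g 0 * h (suc n) + ((scale (f 0) (tail g) ⊕ tail f ⊗ g) ⊗ h) n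
    ≡⟨ cong (_+_ (f 0 * g 0 * h (suc n))) (⊗-distribʳ-⊕ h (scale (f 0) (tail g)) (tail f ⊗ g) n) ⟩
  f 0 * g 0 * h (suc n) + ((scale (f 0) (tail g) ⊗ h) n + ((tail f ⊗ g) ⊗ h) n)
    ≡⟨ cong (_+_ (f 0 * g 0 * h (suc n))) (cong₂ _+_ (⊗-scaleˡ (f 0) (tail g) h n) (⊗-assoc (tail f) g h n)) ⟩
  f 0 * g 0 * h (suc n) + (f 0 * (tail g ⊗ h) n + (tail f ⊗ (g ⊗ h)) n)
    ≡⟨ regroup (f 0) (g 0) (h (suc n)) ((tail g ⊗ h) n) ((tail f ⊗ (g ⊗ h)) n) ⟩
  f 0 * (g 0 * h (suc n) + (tail g ⊗ h) n) + (tail f ⊗ (g ⊗ h)) n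
    ≡⟨ cong (λ c → f 0 * c + (tail f ⊗ (g ⊗ h)) n) (⊗-coeff-sucˡ g h n) ⟨
  f 0 * (g ⊗ h) (suc n) + (tail f ⊗ (g ⊗ h)) n
    ≡⟨ ⊗-coeff-sucˡ f (g ⊗ h) n ⟨
  (f ⊗ (g ⊗ h)) (suc n) ∎
  where
  open ≡-Reasoning
  regroup : ∀ a b c d x → a * b * c + (a * d + x) ≡ a * (b * c + d) + x
  regroup = solve-∀

negate : PS → PS
negate f n = - f n

PS-commutativeRing : CommutativeRing 0ℓ 0ℓ
PS-commutativeRing = record
  { Carrier = PS
  ; _≈_ = _≋_
  ; _+_ = _⊕_
  ; _*_ = _⊗_
  ; -_ = negate
  ; 0# = 0ₛ
  ; 1# = one
  ; isCommutativeRing = record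
    { isRing = record
      { +-isAbelianGroup = Pointwise.isAbelianGroup ℕ ℤP.+-0-isAbelianGroup
      ; *-cong = ⊗-cong
      ; *-assoc = ⊗-assoc
      ; *-identity = ⊗-identityˡ , ⊗-identityʳ
      ; distrib = ⊗-distribˡ-⊕ , ⊗-distribʳ-⊕
      }
    ; *-comm = ⊗-comm
    }
  }

const-homomorphism : ℤ.+-*-rawRing -Raw-AlmostCommutative⟶ fromCommutativeRing PS-commutativeRing
const-homomorphism = record
  { ⟦_⟧ = const
  ; +-homo = λ a b → λ { zero → refl ; (suc n) → refl }
  ; *-homo = λ a b n → sym (trans (const-⊗ a (const b) n) (scaled a b n))
  ; -‿homo = λ a → λ { zero → refl ; (suc n) → refl }
  ; 0-homo = λ { zero → refl ; (suc n) → refl }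
  ; 1-homo = ≋-refl
  }
  where
  scaled : ∀ a b → scale a (const b) ≋ const (a * b)
  scaled a b zero    = refl
  scaled a b (suc n) = ℤP.*-zeroʳ a

const-≟ : WeaklyDecidable (Induced-equivalence const-homomorphism)
const-≟ a b with a ℤ.≟ b
... | yes a≡b = just (λ n → cong (λ c → const c n) a≡b)
... | no _    = nothing

module PS-Solver = Algebra.Solver.Ring ℤ.+-*-rawRing (fromCommutativeRing PS-commutativeRing)
  const-homomorphism const-≟

open import Algebra.Properties.Semiring.Exp (CommutativeRing.semiring PS-commutativeRing) using (_^_)

x : PS
x = z^ 1

shift : ℕ → PS → PS
shift zero    f n       = f n
shift (suc k) f zero    = + 0
shift (suc k) f (suc n) = shift k f n

mono-suc : ∀ c k n → mono c (suc k) (suc n) ≡ mono c k n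
mono-suc c k n with k ℕ.≟ n | suc k ℕ.≟ suc n
... | yes _   | yes _    = refl
... | no _    | no _     = refl
... | yes k≡n | no sk≢sn = ⊥-elim (sk≢sn (cong suc k≡n))
... | no k≢n  | yes sk≡sn = ⊥-elim (k≢n (ℕP.suc-injective sk≡sn))

x-⊗ : ∀ f → x ⊗ f ≋ shift 1 f
x-⊗ f zero    = trans (⊗-coeff-zero x f) (ℤP.*-zeroˡ (f 0))
x-⊗ f (suc n) = trans (⊗-coeff-sucˡ x f n)
  (trans (ℤP.+-identityˡ ((tail x ⊗ f) n)) (trans (⊗-cong (mono-suc (+ 1) 0) ≋-refl n) (⊗-identityˡ f n)))

x^-⊗ : ∀ k f → x ^ k ⊗ f ≋ shift k f
x^-⊗ zero    f n       = ⊗-identityˡ f n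
x^-⊗ (suc k) f zero    = trans (⊗-assoc x (x ^ k) f 0) (x-⊗ (x ^ k ⊗ f) 0)
x^-⊗ (suc k) f (suc n) = trans (⊗-assoc x (x ^ k) f (suc n)) (trans (x-⊗ (x ^ k ⊗ f) (suc n)) (x^-⊗ k f n))

mono≋x^-⊗-const : ∀ c k → mono c k ≋ x ^ k ⊗ const c
mono≋x^-⊗-const c k n = trans (mono≋shift k n) (sym (x^-⊗ k (const c) n))
  where
  mono≋shift : ∀ k → mono c k ≋ shift k (const c)
  mono≋shift zero    n       = refl
  mono≋shift (suc k) zero    = refl
  mono≋shift (suc k) (suc n) = trans (mono-suc c k n) (mono≋shift k n)

z^≋x^ : ∀ k → z^ k ≋ x ^ k
z^≋x^ k n = trans (mono≋x^-⊗-const (+ 1) k n) (⊗-identityʳ (x ^ k) n)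

shift-+ : ∀ k f n → shift k f (k ℕ.+ n) ≡ f n
shift-+ zero    f n = refl
shift-+ (suc k) f n = shift-+ k f n

AgreeBelow : ℕ → PS → PS → Set
AgreeBelow n f g = ∀ i → i < n → f i ≡ g i

shift-suc-agree : ∀ k {f g} n → AgreeBelow n f g → shift (suc k) f n ≡ shift (suc k) g n
shift-suc-agree k       zero    _   = refl
shift-suc-agree zero    (suc n) f≈g = f≈g n ℕP.≤-refl
shift-suc-agree (suc k) (suc n) f≈g = shift-suc-agree k n (λ i i<n → f≈g i (ℕP.m<n⇒m<1+n i<n))

x^suc-⊗-agree : ∀ k {f g} n → AgreeBelow n f g → (x ^ suc k ⊗ f) n ≡ (x ^ suc k ⊗ g) n
x^suc-⊗-agree k {f} {g} n f≈g =
  trans (x^-⊗ (suc k) f n) (trans (shift-suc-agree k n f≈g) (sym (x^-⊗ (suc k) g n)))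

convAux-agree : ∀ {f f′ g g′} n k → k ≤ suc n → AgreeBelow (suc n) f f′ → AgreeBelow (suc n) g g′ →
  convAux f g n k ≡ convAux f′ g′ n k
convAux-agree n zero    _   f≈ g≈ = refl
convAux-agree n (suc k) k<n f≈ g≈ = cong₂ _+_ (convAux-agree n k (ℕP.<⇒≤ k<n) f≈ g≈)
  (cong₂ _*_ (f≈ k k<n) (g≈ (n ∸ k) (s≤s (ℕP.m∸n≤m n k))))

⊗-agree : ∀ {f f′ g g′} n → AgreeBelow (suc n) f f′ → AgreeBelow (suc n) g g′ → (f ⊗ g) n ≡ (f′ ⊗ g′) n
⊗-agree n = convAux-agree n (suc n) ℕP.≤-refl

Contractive : (PS → PS) → Set
Contractive Φ = ∀ f g n → AgreeBelow n f g → Φ f n ≡ Φ g n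

module Fixpoint (Φ : PS → PS) (Φ-contractive : Contractive Φ) where

  iterate : ℕ → PS
  iterate zero    = 0ₛ
  iterate (suc m) = Φ (iterate m)

  iterate-step : ∀ m j → j < m → iterate m j ≡ iterate (suc m) j
  iterate-step (suc m) j (s≤s j≤m) = Φ-contractive (iterate m) (iterate (suc m)) j
    (λ i i<j → iterate-step m i (ℕP.<-≤-trans i<j j≤m))

  iterate-stable : ∀ m j → j < m → iterate m j ≡ iterate (suc j) j
  iterate-stable (suc m) j (s≤s j≤m) with ℕP.m≤n⇒m<n∨m≡n j≤m
  ... | inj₂ refl = refl
  ... | inj₁ j<m  = trans (sym (iterate-step m j j<m)) (iterate-stable m j j<m)

  fixpoint : PS
  fixpoint n = iterate (suc n) n

  fixpoint-≋ : fixpoint ≋ Φ fixpoint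
  fixpoint-≋ n = Φ-contractive (iterate n) fixpoint n (λ j j<n → iterate-stable n j j<n)

FamilyContractive : ((ℕ → PS) → ℕ → PS) → Set
FamilyContractive Ψ = ∀ F G n → (∀ h → AgreeBelow n (F h) (G h)) → ∀ h → Ψ F h n ≡ Ψ G h n

fixed-families-unique : ∀ {Ψ} → FamilyContractive Ψ → ∀ {F G} →
  (∀ h → F h ≋ Ψ F h) → (∀ h → G h ≋ Ψ G h) → ∀ h → F h ≋ G h
fixed-families-unique {Ψ} Ψ-contractive {F} {G} F-fixed G-fixed h n =
  <-rec (λ n → ∀ h → F h n ≡ G h n) step n h
  where
  step : ∀ n → (∀ {i} → i < n → ∀ h → F h i ≡ G h i) → ∀ h → F h n ≡ G h n
  step n earlier h = trans (F-fixed h n)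
    (trans (Ψ-contractive F G n (λ h i i<n → earlier i<n h) h) (sym (G-fixed h n)))

module ≋-Reasoning = Relation.Binary.Reasoning.Setoid (CommutativeRing.setoid PS-commutativeRing)

⊕-cong : ∀ {f f′ g g′} → f ≋ f′ → g ≋ g′ → f ⊕ g ≋ f′ ⊕ g′
⊕-cong f≋ g≋ n = cong₂ _+_ (f≋ n) (g≋ n)

⊖-cong : ∀ {f f′ g g′} → f ≋ f′ → g ≋ g′ → f ⊖ g ≋ f′ ⊖ g′
⊖-cong f≋ g≋ n = cong₂ _-_ (f≋ n) (g≋ n)

⊗-vanishes : ∀ f {g} → g ≋ 0ₛ → f ⊗ g ≋ 0ₛ
⊗-vanishes f {g} g≋0 n = trans (⊗-comm f g n) (trans (⊗-cong g≋0 ≋-refl n) (⊗-zeroˡ f n))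

x^-⊗-cancel : ∀ k {f} → x ^ k ⊗ f ≋ 0ₛ → f ≋ 0ₛ
x^-⊗-cancel k {f} x^kf≋0 n = trans (sym (shift-+ k f n)) (trans (sym (x^-⊗ k f (k ℕ.+ n))) (x^kf≋0 (k ℕ.+ n)))

const-⊗-cancel : ∀ c {f} → c ≢ + 0 → const c ⊗ f ≋ 0ₛ → f ≋ 0ₛ
const-⊗-cancel c {f} c≢0 cf≋0 n with ℤP.i*j≡0⇒i≡0∨j≡0 c (trans (sym (const-⊗ c f n)) (cf≋0 n))
... | inj₁ c≡0  = ⊥-elim (c≢0 c≡0)
... | inj₂ fn≡0 = fn≡0

kernelMap : PS → PS
kernelMap r = x ^ 3 ⊕ x ^ 2 ⊗ r ⊕ x ^ 4 ⊗ r ⊕ x ^ 3 ⊗ (r ⊗ r)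

IsKernelRoot : PS → Set
IsKernelRoot r = r ≋ kernelMap r

kernel-defect≋0 : ∀ {r} → IsKernelRoot r → kernelMap r ⊖ r ≋ 0ₛ
kernel-defect≋0 {r} r-root n = trans (cong (_- r n) (sym (r-root n))) (ℤP.+-inverseʳ (r n))

kernelMap-contractive : Contractive kernelMap
kernelMap-contractive f g n f≈g =
  cong₂ _+_ (cong₂ _+_ (cong (_+_ ((x ^ 3) n)) (x^suc-⊗-agree 1 n f≈g)) (x^suc-⊗-agree 3 n f≈g))
    (x^suc-⊗-agree 2 n (λ i i<n → ⊗-agree i (upto i<n) (upto i<n)))
  where
  upto : ∀ {i} → i < n → AgreeBelow (suc i) f g
  upto i<n j j≤i = f≈g j (ℕP.≤-<-trans (ℕP.≤-pred j≤i) i<n)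

kernelRoot : PS
kernelRoot = Fixpoint.fixpoint kernelMap kernelMap-contractive

kernelRoot-isKernelRoot : IsKernelRoot kernelRoot
kernelRoot-isKernelRoot = Fixpoint.fixpoint-≋ kernelMap kernelMap-contractive

Numer≋ : Numer ≋ one ⊖ x ^ 4 ⊖ x ^ 2
Numer≋ = ⊖-cong (⊖-cong (≋-refl {one}) (z^≋x^ 4)) (z^≋x^ 2)

Disc≋ : Disc ≋ x ^ 8 ⊖ x ^ 6 ⊗ const (+ 2) ⊖ x ^ 4 ⊖ x ^ 2 ⊗ const (+ 2) ⊕ one
Disc≋ = ⊕-cong (⊖-cong (⊖-cong (⊖-cong (z^≋x^ 8) (mono≋x^-⊗-const (+ 2) 6)) (z^≋x^ 4))
  (mono≋x^-⊗-const (+ 2) 2)) (≋-refl {one})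

sqrtOf : PS → PS
sqrtOf r = Numer ⊖ mono (+ 2) 3 ⊗ r

sqrtOf-square : ∀ r → sqrtOf r ⊗ sqrtOf r ≋ Disc ⊕ const (+ 4) ⊗ x ^ 3 ⊗ (kernelMap r ⊖ r)
sqrtOf-square r = begin
  sqrtOf r ⊗ sqrtOf r
    ≈⟨ ⊗-cong s≋ s≋ ⟩
  (one ⊖ x ^ 4 ⊖ x ^ 2 ⊖ x ^ 3 ⊗ const (+ 2) ⊗ r) ⊗ (one ⊖ x ^ 4 ⊖ x ^ 2 ⊖ x ^ 3 ⊗ const (+ 2) ⊗ r)
    ≈⟨ PS-Solver.solve 2 (λ X R →
         let S = con (+ 1) :- X :^ 4 :- X :^ 2 :- X :^ 3 :* con (+ 2) :* R
             K = X :^ 3 :+ X :^ 2 :* R :+ X :^ 4 :* R :+ X :^ 3 :* (R :* R)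
         in S :* S := X :^ 8 :- X :^ 6 :* con (+ 2) :- X :^ 4 :- X :^ 2 :* con (+ 2) :+ con (+ 1)
                      :+ con (+ 4) :* X :^ 3 :* (K :- R)) ≋-refl x r ⟩
  (x ^ 8 ⊖ x ^ 6 ⊗ const (+ 2) ⊖ x ^ 4 ⊖ x ^ 2 ⊗ const (+ 2) ⊕ one) ⊕ const (+ 4) ⊗ x ^ 3 ⊗ (kernelMap r ⊖ r)
    ≈⟨ ⊕-cong Disc≋ ≋-refl ⟨
  Disc ⊕ const (+ 4) ⊗ x ^ 3 ⊗ (kernelMap r ⊖ r) ∎
  where
  open ≋-Reasoning
  open PS-Solver using (con; _:+_; _:-_; _:*_; _:^_; _:=_)
  s≋ : sqrtOf r ≋ one ⊖ x ^ 4 ⊖ x ^ 2 ⊖ x ^ 3 ⊗ const (+ 2) ⊗ r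
  s≋ = ⊖-cong Numer≋ (⊗-cong (mono≋x^-⊗-const (+ 2) 3) ≋-refl)

sub-sub : ∀ a b → a - (a - b) ≡ b
sub-sub = solve-∀

IsR⇒≋sqrtOf : ∀ {s r} → IsR s r → s ≋ sqrtOf r
IsR⇒≋sqrtOf {s} {r} isR n = trans (sym (sub-sub (Numer n) (s n))) (cong (_-_ (Numer n)) (sym (isR n)))

sqrtDisc⇒kernelRoot : ∀ {s r} → IsSqrtDisc s → IsR s r → IsKernelRoot r
sqrtDisc⇒kernelRoot {s} {r} (_ , s²≋Disc) isR n = sym (ℤP.i-j≡0⇒i≡j (kernelMap r n) (r n) (defect≋0 n))
  where
  excess≋0 : const (+ 4) ⊗ x ^ 3 ⊗ (kernelMap r ⊖ r) ≋ 0ₛ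
  excess≋0 m = begin
    excess                                ≡⟨ add-sub (Disc m) excess ⟩
    (Disc m + excess) - Disc m            ≡⟨ cong (_- Disc m) (sqrtOf-square r m) ⟨
    (sqrtOf r ⊗ sqrtOf r) m - Disc m      ≡⟨ cong (_- Disc m) (⊗-cong (IsR⇒≋sqrtOf isR) (IsR⇒≋sqrtOf isR) m) ⟨
    (s ⊗ s) m - Disc m                    ≡⟨ cong (_- Disc m) (s²≋Disc m) ⟩
    Disc m - Disc m                       ≡⟨ ℤP.+-inverseʳ (Disc m) ⟩
    + 0                                   ∎
    where
    open ≡-Reasoning
    excess = (const (+ 4) ⊗ x ^ 3 ⊗ (kernelMap r ⊖ r)) m
    add-sub : ∀ a b → b ≡ (a + b) - a
    add-sub = solve-∀
  defect≋0 : kernelMap r ⊖ r ≋ 0ₛ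
  defect≋0 = x^-⊗-cancel 3 (const-⊗-cancel (+ 4) (λ ())
    (λ m → trans (sym (⊗-assoc (const (+ 4)) (x ^ 3) (kernelMap r ⊖ r) m)) (excess≋0 m)))

kernelRoot⇒sqrtDisc : ∀ {r} → IsKernelRoot r → IsSqrtDisc (sqrtOf r) × IsR (sqrtOf r) r
kernelRoot⇒sqrtDisc {r} r-root = (refl , square) , isR
  where
  square : sqrtOf r ⊗ sqrtOf r ≋ Disc
  square n = trans (sqrtOf-square r n)
    (trans (cong (_+_ (Disc n)) (⊗-vanishes (const (+ 4) ⊗ x ^ 3) (kernel-defect≋0 r-root) n))
           (ℤP.+-identityʳ (Disc n)))
  isR : IsR (sqrtOf r) r
  isR n = sym (sub-sub (Numer n) ((mono (+ 2) 3 ⊗ r) n))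

fibonacci : PS
fibonacci zero          = + 1
fibonacci (suc zero)    = + 1
fibonacci (suc (suc n)) = fibonacci (suc n) + fibonacci n

fibonacci-inverse : (one ⊖ x ⊖ x ^ 2) ⊗ fibonacci ≋ one
fibonacci-inverse n = begin
  ((one ⊖ x ⊖ x ^ 2) ⊗ fibonacci) n
    ≡⟨ PS-Solver.solve 2 (λ X F → (con (+ 1) :- X :- X :^ 2) :* F := F :- X :* F :- X :^ 2 :* F) ≋-refl x fibonacci n ⟩
  fibonacci n - (x ⊗ fibonacci) n - (x ^ 2 ⊗ fibonacci) n
    ≡⟨ cong₂ _-_ (cong (_-_ (fibonacci n)) (x-⊗ fibonacci n)) (x^-⊗ 2 fibonacci n) ⟩
  fibonacci n - shift 1 fibonacci n - shift 2 fibonacci n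
    ≡⟨ coefficients n ⟩
  one n ∎
  where
  open ≡-Reasoning
  open PS-Solver using (con; _:-_; _:*_; _:^_; _:=_)
  coefficients : ∀ n → fibonacci n - shift 1 fibonacci n - shift 2 fibonacci n ≡ one n
  coefficients zero          = refl
  coefficients (suc zero)    = refl
  coefficients (suc (suc n)) = cancel (fibonacci (suc n)) (fibonacci n)
    where
    cancel : ∀ a b → a + b - a - b ≡ + 0
    cancel = solve-∀

vanishing-combination : ∀ a b c {e₁ e₂} → e₁ ≋ 0ₛ → e₂ ≋ 0ₛ → a ⊕ b ⊗ e₁ ⊕ c ⊗ e₂ ≋ a
vanishing-combination a b c e₁≋0 e₂≋0 n =
  trans (cong₂ (λ u v → a n + u + v) (⊗-vanishes b e₁≋0 n) (⊗-vanishes c e₂≋0 n))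
    (trans (ℤP.+-identityʳ (a n + + 0)) (ℤP.+-identityʳ (a n)))

fibonacci-defect≋0 : (one ⊖ x ⊖ x ^ 2) ⊗ fibonacci ⊖ one ≋ 0ₛ
fibonacci-defect≋0 n = trans (cong (_- one n) (fibonacci-inverse n)) (ℤP.+-inverseʳ (one n))

1+x+x² : PS
1+x+x² = one ⊕ x ⊕ x ^ 2

below : (ℕ → PS) → ℕ → PS
below F zero    = 0ₛ
below F (suc h) = F h

heightStep : (ℕ → PS) → ℕ → PS
heightStep F h = 1+x+x² ⊕ x ^ 2 ⊗ F h ⊕ x ^ 4 ⊗ F h ⊕ x ^ 3 ⊗ F (suc h) ⊕ x ^ 3 ⊗ below F h

heightStep-contractive : FamilyContractive heightStep
heightStep-contractive F G n F≈G h =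
  cong₂ _+_ (cong₂ _+_ (cong₂ _+_ (cong (_+_ (1+x+x² n)) (x^suc-⊗-agree 1 n (F≈G h))) (x^suc-⊗-agree 3 n (F≈G h)))
                       (x^suc-⊗-agree 2 n (F≈G (suc h))))
            (x^suc-⊗-agree 2 n (below-agree h))
  where
  below-agree : ∀ h → AgreeBelow n (below F h) (below G h)
  below-agree zero    _ _ = refl
  below-agree (suc h)     = F≈G h

-- heightSolution r (suc h) is U_h = (1 - r^{h+1}) / (1 - z - z²).
heightSolution : PS → ℕ → PS
heightSolution r h = fibonacci ⊗ (one ⊖ r ^ h)

heightSolution-recurrence : ∀ {r} → IsKernelRoot r → ∀ h →
  heightSolution r (suc h) ≋ heightStep (λ h → heightSolution r (suc h)) h
heightSolution-recurrence {r} r-root h = begin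
  Y (suc h)
    ≈⟨ PS-Solver.solve 4 (λ X R P T →
         let Y = λ U → P :* (con (+ 1) :- U)
             K = X :^ 3 :+ X :^ 2 :* R :+ X :^ 4 :* R :+ X :^ 3 :* (R :* R)
             Q′ = con (+ 1) :+ X :+ X :^ 2
         in Y (R :* T) := Q′ :+ X :^ 2 :* Y (R :* T) :+ X :^ 4 :* Y (R :* T) :+ X :^ 3 :* Y (R :* (R :* T))
                          :+ X :^ 3 :* Y T
                          :+ Q′ :* ((con (+ 1) :- X :- X :^ 2) :* P :- con (+ 1)) :+ P :* T :* (K :- R))
         ≋-refl x r fibonacci (r ^ h) ⟩
  heightStep′ ⊕ 1+x+x² ⊗ ((one ⊖ x ⊖ x ^ 2) ⊗ fibonacci ⊖ one) ⊕ fibonacci ⊗ r ^ h ⊗ (kernelMap r ⊖ r)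
    ≈⟨ vanishing-combination heightStep′ 1+x+x² (fibonacci ⊗ r ^ h) fibonacci-defect≋0 (kernel-defect≋0 r-root) ⟩
  heightStep′
    ≈⟨ ⊕-cong (≋-refl {1+x+x² ⊕ x ^ 2 ⊗ Y (suc h) ⊕ x ^ 4 ⊗ Y (suc h) ⊕ x ^ 3 ⊗ Y (suc (suc h))})
         (⊗-cong (≋-refl {x ^ 3}) (below≋ h)) ⟨
  heightStep (λ h → Y (suc h)) h ∎
  where
  open ≋-Reasoning
  open PS-Solver using (con; _:+_; _:-_; _:*_; _:^_; _:=_)
  Y : ℕ → PS
  Y = heightSolution r
  heightStep′ : PS
  heightStep′ = 1+x+x² ⊕ x ^ 2 ⊗ Y (suc h) ⊕ x ^ 4 ⊗ Y (suc h) ⊕ x ^ 3 ⊗ Y (suc (suc h)) ⊕ x ^ 3 ⊗ Y h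
  below≋ : ∀ h → below (λ h → Y (suc h)) h ≋ Y h
  below≋ zero    = λ n → sym (⊗-vanishes fibonacci (λ m → ℤP.+-inverseʳ (one m)) n)
  below≋ (suc h) = ≋-refl

heightSolution-gf : ∀ {r} → IsKernelRoot r → ∀ {A} → A ≋ heightSolution r 1 →
  z^ 3 ⊗ (one ⊖ r) ⊗ A ≋ r ⊗ z^ 2 ⊕ r ⊗ z^ 1 ⊕ r
heightSolution-gf {r} r-root {A} A≋ = begin
  z^ 3 ⊗ (one ⊖ r) ⊗ A
    ≈⟨ ⊗-cong (⊗-cong (z^≋x^ 3) (≋-refl {one ⊖ r})) A≋ ⟩
  x ^ 3 ⊗ (one ⊖ r) ⊗ heightSolution r 1
    ≈⟨ PS-Solver.solve 3 (λ X R P →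
         let K = X :^ 3 :+ X :^ 2 :* R :+ X :^ 4 :* R :+ X :^ 3 :* (R :* R)
             Q′ = con (+ 1) :+ X :+ X :^ 2
         in X :^ 3 :* (con (+ 1) :- R) :* (P :* (con (+ 1) :- R :^ 1))
              := R :* X :^ 2 :+ R :* X :+ R
                 :+ R :* Q′ :* ((con (+ 1) :- X :- X :^ 2) :* P :- con (+ 1)) :+ P :* (K :- R))
         ≋-refl x r fibonacci ⟩
  r ⊗ x ^ 2 ⊕ r ⊗ x ⊕ r ⊕ r ⊗ 1+x+x² ⊗ ((one ⊖ x ⊖ x ^ 2) ⊗ fibonacci ⊖ one) ⊕ fibonacci ⊗ (kernelMap r ⊖ r)
    ≈⟨ vanishing-combination (r ⊗ x ^ 2 ⊕ r ⊗ x ⊕ r) (r ⊗ 1+x+x²) fibonacci fibonacci-defect≋0 (kernel-defect≋0 r-root) ⟩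
  r ⊗ x ^ 2 ⊕ r ⊗ x ⊕ r
    ≈⟨ ⊕-cong (⊕-cong (⊗-cong (≋-refl {r}) (z^≋x^ 2)) (≋-refl {r ⊗ x})) (≋-refl {r}) ⟨
  r ⊗ z^ 2 ⊕ r ⊗ z^ 1 ⊕ r ∎
  where
  open ≋-Reasoning
  open PS-Solver using (con; _:+_; _:-_; _:*_; _:^_; _:=_)

-- Zigzag h up p: p starts at height h, never goes below the axis, alternates, and its first
-- step (if any) is an up-step exactly when up = true.
data Zigzag : ℕ → Bool → Path → Set where
  []  : ∀ {h b} → Zigzag h b []
  N∷_ : ∀ {h p} → Zigzag (suc (suc h)) false p → Zigzag h true (N ∷ p)
  E∷_ : ∀ {h p} → Zigzag (suc h) false p → Zigzag h true (E ∷ p)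
  N̄∷_ : ∀ {h p} → Zigzag h true p → Zigzag (suc (suc h)) false (N̄ ∷ p)
  Ē∷_ : ∀ {h p} → Zigzag h true p → Zigzag (suc h) false (Ē ∷ p)

height-N : ∀ h → + h ℤ.+ dy N ≡ + suc (suc h)
height-N h = cong +_ (ℕP.+-comm h 2)

height-E : ∀ h → + h ℤ.+ dy E ≡ + suc h
height-E h = cong +_ (ℕP.+-comm h 1)

staysAbove-∷ : ∀ {h h′} s {p} → + h ℤ.+ dy s ≡ + h′ → StaysAbove (+ h′) p → StaysAbove (+ h) (s ∷ p)
staysAbove-∷ s {p} step sa = subst (λ k → (+ 0 ℤ.≤ k) × StaysAbove k p) (sym step) (ℤ.+≤+ z≤n , sa)

zigzag-staysAbove : ∀ {h b p} → Zigzag h b p → StaysAbove (+ h) p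
zigzag-staysAbove []             = tt
zigzag-staysAbove {h} (N∷ z)     = staysAbove-∷ N (height-N h) (zigzag-staysAbove z)
zigzag-staysAbove {h} (E∷ z)     = staysAbove-∷ E (height-E h) (zigzag-staysAbove z)
zigzag-staysAbove (N̄∷ z)         = staysAbove-∷ {suc (suc _)} N̄ refl (zigzag-staysAbove z)
zigzag-staysAbove (Ē∷ z)         = staysAbove-∷ {suc _} Ē refl (zigzag-staysAbove z)

Leads : Bool → Path → Set
Leads b []      = ⊤
Leads b (s ∷ _) = isUp s ≡ b

zigzag-leads : ∀ {h b p} → Zigzag h b p → Leads b p
zigzag-leads []      = tt
zigzag-leads (N∷ _)  = refl
zigzag-leads (E∷ _)  = refl
zigzag-leads (N̄∷ _)  = refl
zigzag-leads (Ē∷ _)  = refl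

alternating-∷ : ∀ {s p} → Leads (not (isUp s)) p → Alternating p → Alternating (s ∷ p)
alternating-∷ {p = []}    _     _   = tt
alternating-∷ {p = _ ∷ _} leads alt = leads , alt

alternating-tail : ∀ {s p} → Alternating (s ∷ p) → Alternating p
alternating-tail {p = []}    _         = tt
alternating-tail {p = _ ∷ _} (_ , alt) = alt

alternating-leads : ∀ {s p} → Alternating (s ∷ p) → Leads (not (isUp s)) p
alternating-leads {p = []}    _         = tt
alternating-leads {p = _ ∷ _} (leads , _) = leads

zigzag-alternating : ∀ {h b p} → Zigzag h b p → Alternating p
zigzag-alternating []     = tt
zigzag-alternating (N∷ z) = alternating-∷ (zigzag-leads z) (zigzag-alternating z)
zigzag-alternating (E∷ z) = alternating-∷ (zigzag-leads z) (zigzag-alternating z)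
zigzag-alternating (N̄∷ z) = alternating-∷ (zigzag-leads z) (zigzag-alternating z)
zigzag-alternating (Ē∷ z) = alternating-∷ (zigzag-leads z) (zigzag-alternating z)

toZigzag : ∀ {h b} p → StaysAbove (+ h) p → Alternating p → Leads b p → Zigzag h b p
toZigzag []      _ _ _ = []
toZigzag {h} (N ∷ p) (_ , sa) alt refl =
  N∷ toZigzag p (subst (λ k → StaysAbove k p) (height-N h) sa) (alternating-tail alt) (alternating-leads alt)
toZigzag {h} (E ∷ p) (_ , sa) alt refl =
  E∷ toZigzag p (subst (λ k → StaysAbove k p) (height-E h) sa) (alternating-tail alt) (alternating-leads alt)
toZigzag {suc (suc h)} (N̄ ∷ p) (_ , sa) alt refl = N̄∷ toZigzag p sa (alternating-tail alt) (alternating-leads alt)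
toZigzag {suc zero}    (N̄ ∷ p) (() , _) _ _
toZigzag {zero}        (N̄ ∷ p) (() , _) _ _
toZigzag {suc h}       (Ē ∷ p) (_ , sa) alt refl = Ē∷ toZigzag p sa (alternating-tail alt) (alternating-leads alt)
toZigzag {zero}        (Ē ∷ p) (() , _) _ _

staysAbove-ground-leads-up : ∀ p → StaysAbove (+ 0) p → Leads true p
staysAbove-ground-leads-up []      _        = tt
staysAbove-ground-leads-up (N ∷ _) _        = refl
staysAbove-ground-leads-up (E ∷ _) _        = refl
staysAbove-ground-leads-up (N̄ ∷ _) (() , _)
staysAbove-ground-leads-up (Ē ∷ _) (() , _)

zigzag-prefix : ∀ {h b} p {q} → Zigzag h b (p ++ q) → Zigzag h b p
zigzag-prefix []      _      = []
zigzag-prefix (N ∷ p) (N∷ z) = N∷ zigzag-prefix p z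
zigzag-prefix (E ∷ p) (E∷ z) = E∷ zigzag-prefix p z
zigzag-prefix (N̄ ∷ p) (N̄∷ z) = N̄∷ zigzag-prefix p z
zigzag-prefix (Ē ∷ p) (Ē∷ z) = Ē∷ zigzag-prefix p z

ReturnsToGround : ℕ → Path → Set
ReturnsToGround h q = endHeight (+ h) q ≡ + 0

-- Descend by Ē, and by E N̄ (net height −1) when the next step must go up.
descent : ∀ h b → ∃ λ q → Zigzag h b q × ReturnsToGround h q
descent zero    b     = [] , [] , refl
descent (suc h) true  with descent h true
... | q , z , ret = E ∷ N̄ ∷ q , E∷ N̄∷ z , trans (cong (λ k → endHeight (k ℤ.+ dy N̄) q) (height-E (suc h))) ret
descent (suc h) false with descent h true
... | q , z , ret = Ē ∷ q , Ē∷ z , ret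

zigzag-completion : ∀ {h b p} → Zigzag h b p → ∃ λ q → Zigzag h b (p ++ q) × ReturnsToGround h (p ++ q)
zigzag-completion {h} {b} [] = descent h b
zigzag-completion {h} (N∷_ {p = p} z) with zigzag-completion z
... | q , z′ , ret = q , N∷ z′ , trans (cong (λ k → endHeight k (p ++ q)) (height-N h)) ret
zigzag-completion {h} (E∷_ {p = p} z) with zigzag-completion z
... | q , z′ , ret = q , E∷ z′ , trans (cong (λ k → endHeight k (p ++ q)) (height-E h)) ret
zigzag-completion (N̄∷ z) with zigzag-completion z
... | q , z′ , ret = q , N̄∷ z′ , ret
zigzag-completion (Ē∷ z) with zigzag-completion z
... | q , z′ , ret = q , Ē∷ z′ , ret

partialZigzag⇔zigzag : ∀ p → PartialZigzag p ⇔ Zigzag 0 true p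
partialZigzag⇔zigzag p = mk⇔ to from
  where
  to : PartialZigzag p → Zigzag 0 true p
  to (q , (sa , _) , alt) = zigzag-prefix p (toZigzag (p ++ q) sa alt (staysAbove-ground-leads-up (p ++ q) sa))
  from : Zigzag 0 true p → PartialZigzag p
  from z with zigzag-completion z
  ... | q , z′ , ret = q , (zigzag-staysAbove z′ , ret) , zigzag-alternating z′

mutual
  paths : ℕ → ℕ → Bool → List Path
  paths zero    h b     = [] ∷ []
  paths (suc n) h true  = map (N ∷_) (continuations N n h) ++ map (E ∷_) (continuations E n h)
  paths (suc n) h false = map (N̄ ∷_) (continuations N̄ n h) ++ map (Ē ∷_) (continuations Ē n h)

  continuations : Step → ℕ → ℕ → List Path
  continuations N n             h             = paths n (suc (suc h)) false
  continuations E zero          h             = []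
  continuations E (suc n)       h             = paths n (suc h) false
  continuations N̄ n             (suc (suc h)) = paths n h true
  continuations N̄ n             _             = []
  continuations Ē (suc n)       (suc h)       = paths n h true
  continuations Ē _             _             = []

count : ℕ → ℕ → Bool → ℕ
count n h b = length (paths n h b)

mutual
  paths-sound : ∀ n h b {p} → p ∈ paths n h b → Zigzag h b p × size p ≡ n
  paths-sound zero    h b     (here refl) = [] , refl
  paths-sound (suc n) h true  p∈ with ∈-++⁻ (map (N ∷_) (continuations N n h)) p∈
  ... | inj₁ p∈N = heads-sound N n h p∈N
  ... | inj₂ p∈E = heads-sound E n h p∈E
  paths-sound (suc n) h false p∈ with ∈-++⁻ (map (N̄ ∷_) (continuations N̄ n h)) p∈
  ... | inj₁ p∈N̄ = heads-sound N̄ n h p∈N̄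
  ... | inj₂ p∈Ē = heads-sound Ē n h p∈Ē

  heads-sound : ∀ s n h {p} → p ∈ map (s ∷_) (continuations s n h) → Zigzag h (isUp s) p × size p ≡ suc n
  heads-sound s n h p∈ with ∈-map⁻ (s ∷_) p∈
  ... | q , q∈ , refl = continuations-sound s n h q∈

  continuations-sound : ∀ s n h {q} → q ∈ continuations s n h → Zigzag h (isUp s) (s ∷ q) × size (s ∷ q) ≡ suc n
  continuations-sound N n       h             q∈ with paths-sound n (suc (suc h)) false q∈
  ... | z , refl = N∷ z , refl
  continuations-sound E (suc n) h             q∈ with paths-sound n (suc h) false q∈
  ... | z , refl = E∷ z , refl
  continuations-sound N̄ n       (suc (suc h)) q∈ with paths-sound n h true q∈
  ... | z , refl = N̄∷ z , refl
  continuations-sound Ē (suc n) (suc h)       q∈ with paths-sound n h true q∈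
  ... | z , refl = Ē∷ z , refl

paths-complete : ∀ {h b p} → Zigzag h b p → p ∈ paths (size p) h b
paths-complete []     = here refl
paths-complete (N∷ z) = ∈-++⁺ˡ (∈-map⁺ (N ∷_) (paths-complete z))
paths-complete {h} (E∷_ {p = q} z) =
  ∈-++⁺ʳ (map (N ∷_) (continuations N (suc (size q)) h)) (∈-map⁺ (E ∷_) (paths-complete z))
paths-complete (N̄∷ z) = ∈-++⁺ˡ (∈-map⁺ (N̄ ∷_) (paths-complete z))
paths-complete {suc h} (Ē∷_ {p = q} z) =
  ∈-++⁺ʳ (map (N̄ ∷_) (continuations N̄ (suc (size q)) (suc h))) (∈-map⁺ (Ē ∷_) (paths-complete z))

unique-heads : ∀ {s t} → s ≢ t → ∀ {xs ys : List Path} → Unique xs → Unique ys →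
  Unique (map (s ∷_) xs ++ map (t ∷_) ys)
unique-heads {s} {t} s≢t {xs} {ys} uxs uys =
  Unique.++⁺ (Unique.map⁺ ∷-injectiveʳ uxs) (Unique.map⁺ ∷-injectiveʳ uys) disjoint
  where
  disjoint : ∀ {v} → v ∈ map (s ∷_) xs × v ∈ map (t ∷_) ys → ⊥
  disjoint (v∈s , v∈t) with ∈-map⁻ (s ∷_) v∈s | ∈-map⁻ (t ∷_) v∈t
  ... | _ , _ , refl | _ , _ , v≡t∷ = s≢t (∷-injectiveˡ v≡t∷)

mutual
  paths-unique : ∀ n h b → Unique (paths n h b)
  paths-unique zero    h b     = [] ∷ []
  paths-unique (suc n) h true  = unique-heads (λ ()) (continuations-unique N n h) (continuations-unique E n h)
  paths-unique (suc n) h false = unique-heads (λ ()) (continuations-unique N̄ n h) (continuations-unique Ē n h)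

  continuations-unique : ∀ s n h → Unique (continuations s n h)
  continuations-unique N n       h             = paths-unique n (suc (suc h)) false
  continuations-unique E zero    h             = []
  continuations-unique E (suc n) h             = paths-unique n (suc h) false
  continuations-unique N̄ n       (suc (suc h)) = paths-unique n h true
  continuations-unique N̄ n       zero          = []
  continuations-unique N̄ n       (suc zero)    = []
  continuations-unique Ē (suc n) (suc h)       = paths-unique n h true
  continuations-unique Ē zero    h             = []
  continuations-unique Ē (suc n) zero          = []

paths-isCount : ∀ n → IsCount n (count n 0 true)
paths-isCount n = paths n 0 true , paths-unique n 0 true , (λ p → mk⇔ (to p) (from p)) , refl
  where
  to : ∀ p → p ∈ paths n 0 true → PartialZigzag p × size p ≡ n
  to p p∈ with paths-sound n 0 true p∈
  ... | z , size≡ = Equivalence.from (partialZigzag⇔zigzag p) z , size≡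
  from : ∀ p → PartialZigzag p × size p ≡ n → p ∈ paths n 0 true
  from p (pz , refl) = paths-complete (Equivalence.to (partialZigzag⇔zigzag p) pz)

isCount-unique : ∀ {n k k′} → IsCount n k → IsCount n k′ → k ≡ k′
isCount-unique (L , uL , L⇔ , refl) (L′ , uL′ , L′⇔ , refl) =
  ↭-length (∼bag⇒↭ (unique∧set⇒bag uL uL′ (λ {p} → mk⇔
    (λ p∈L → Equivalence.from (L′⇔ p) (Equivalence.to (L⇔ p) p∈L))
    (λ p∈L′ → Equivalence.from (L⇔ p) (Equivalence.to (L′⇔ p) p∈L′)))))

length-heads : ∀ s t (xs ys : List Path) → length (map (s ∷_) xs ++ map (t ∷_) ys) ≡ length xs ℕ.+ length ys
length-heads s t xs ys = trans (length-++ (map (s ∷_) xs)) (cong₂ ℕ._+_ (length-map (s ∷_) xs) (length-map (t ∷_) ys))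

count-recurrence : ∀ h m → count (4 ℕ.+ m) h true ≡
  count (2 ℕ.+ m) h true ℕ.+ count m h true ℕ.+ count (1 ℕ.+ m) (1 ℕ.+ h) true
    ℕ.+ length (continuations N̄ (1 ℕ.+ m) (1 ℕ.+ h))
count-recurrence h m = begin
  count (4 ℕ.+ m) h true
    ≡⟨ length-heads N E (paths (3 ℕ.+ m) (2 ℕ.+ h) false) (paths (2 ℕ.+ m) (1 ℕ.+ h) false) ⟩
  count (3 ℕ.+ m) (2 ℕ.+ h) false ℕ.+ count (2 ℕ.+ m) (1 ℕ.+ h) false
    ≡⟨ cong₂ ℕ._+_ (length-heads N̄ Ē (paths (2 ℕ.+ m) h true) (paths (1 ℕ.+ m) (1 ℕ.+ h) true))
                   (length-heads N̄ Ē (continuations N̄ (1 ℕ.+ m) (1 ℕ.+ h)) (paths m h true)) ⟩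
  (A ℕ.+ C) ℕ.+ (D ℕ.+ B)
    ≡⟨ regroup A B C D ⟩
  A ℕ.+ B ℕ.+ C ℕ.+ D ∎
  where
  open ≡-Reasoning
  A = count (2 ℕ.+ m) h true
  B = count m h true
  C = count (1 ℕ.+ m) (1 ℕ.+ h) true
  D = length (continuations N̄ (1 ℕ.+ m) (1 ℕ.+ h))
  regroup : ∀ a b c d → (a ℕ.+ c) ℕ.+ (d ℕ.+ b) ≡ a ℕ.+ b ℕ.+ c ℕ.+ d
  regroup = ℕ-solve-∀

heightCounts : ℕ → PS
heightCounts h n = + count n h true

heightStep-coeff : ∀ F h n → heightStep F h n ≡
  one n + x n + shift 2 one n + shift 2 (F h) n + shift 4 (F h) n + shift 3 (F (suc h)) n + shift 3 (below F h) n
heightStep-coeff F h n =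
  cong₂ _+_ (cong₂ _+_ (cong₂ _+_ (cong₂ _+_
    (cong (_+_ (one n + x n)) (trans (sym (⊗-identityʳ (x ^ 2) n)) (x^-⊗ 2 one n)))
    (x^-⊗ 2 (F h) n)) (x^-⊗ 4 (F h) n)) (x^-⊗ 3 (F (suc h)) n)) (x^-⊗ 3 (below F h) n)

heightCounts-recurrence : ∀ h → heightCounts h ≋ heightStep heightCounts h
heightCounts-recurrence h n = sym (trans (heightStep-coeff heightCounts h n) (coefficients h n))
  where
  coefficients : ∀ h n → one n + x n + shift 2 one n + shift 2 (heightCounts h) n + shift 4 (heightCounts h) n
                           + shift 3 (heightCounts (suc h)) n + shift 3 (below heightCounts h) n ≡ heightCounts h n
  coefficients h       0 = refl
  coefficients h       1 = refl
  coefficients h       2 = refl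
  coefficients zero    3 = refl
  coefficients (suc h) 3 = refl
  coefficients zero    (suc (suc (suc (suc m)))) = cong +_ (sym (count-recurrence zero m))
  coefficients (suc h) (suc (suc (suc (suc m)))) = cong +_ (sym (count-recurrence (suc h) m))

heightCounts≋heightSolution : ∀ {r} → IsKernelRoot r → ∀ h → heightCounts h ≋ heightSolution r (suc h)
heightCounts≋heightSolution r-root =
  fixed-families-unique heightStep-contractive heightCounts-recurrence (heightSolution-recurrence r-root)

corollary2 : (Σ (ℕ → ℕ) λ a → ∀ n → IsCount n (a n))
    × (∀ (a : ℕ → ℕ) → (∀ n → IsCount n (a n)) →
        (Σ PS λ s → Σ PS λ r → IsSqrtDisc s × IsR s r)
        × (∀ s r → IsSqrtDisc s → IsR s r →
            z^ 3 ⊗ (one ⊖ r) ⊗ gf a ≋ r ⊗ z^ 2 ⊕ r ⊗ z^ 1 ⊕ r)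
        × (a 0 ≡ 1) × (a 1 ≡ 1) × (a 2 ≡ 2) × (a 3 ≡ 2) × (a 4 ≡ 4)
        × (a 5 ≡ 5) × (a 6 ≡ 9) × (a 7 ≡ 12) × (a 8 ≡ 21))
corollary2 = ((λ n → count n 0 true) , paths-isCount) , λ a a-counts →
  let a≡count : ∀ n → a n ≡ count n 0 true
      a≡count n = isCount-unique (a-counts n) (paths-isCount n)
  in (sqrtOf kernelRoot , kernelRoot , kernelRoot⇒sqrtDisc kernelRoot-isKernelRoot)
   , (λ s r s-sqrt r-isR → heightSolution-gf (sqrtDisc⇒kernelRoot s-sqrt r-isR)
        (λ n → trans (cong +_ (a≡count n)) (heightCounts≋heightSolution (sqrtDisc⇒kernelRoot s-sqrt r-isR) 0 n)))
   , a≡count 0 , a≡count 1 , a≡count 2 , a≡count 3 , a≡count 4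
   , a≡count 5 , a≡count 6 , a≡count 7 , a≡count 8
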